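{- Let $p$ be a prime with $p \equiv 1 \pmod 4$, and let $F_{(p-1)/4}(p)$ denote the number of integers $x$ with $1 \leq x \leq p-1$, $\operatorname{ord}_p x = (p-1)/4$, and $x^x \equiv x \pmod{p}$. Then: (1) if $p \equiv 1 \pmod 8$, then $F_{(p-1)/4}(p) \leq 2$; (2) if $p \equiv 5 \pmod 8$, then $F_{(p-1)/4}(p) \leq 1$.
   Context: $\operatorname{ord}_p x$ denotes the multiplicative order of $x$ modulo $p$. -}

module Defs where

open import Data.Nat using (ℕ; zero; suc; _+_; _*_; _∸_; _^_; _%_; _≡ᵇ_; NonZero)
open import Data.Nat.Properties using (_≟_)
open import Data.Bool using (Bool; true; false; if_then_else_)
open import Data.List using (List; length; filter; upTo; map)
open import Relation.Nullary.Decidable using (_×-dec_)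

-- Least k with 1 ≤ k ≤ fuel (starting the search at k = start) such that
-- x ^ k ≡ 1 (mod p); returns 0 if no such k exists in the range.
ordSearch : (p x start fuel : ℕ) → .{{NonZero p}} → ℕ
ordSearch p x start zero = 0
ordSearch p x start (suc fuel) =
  if (x ^ start) % p ≡ᵇ 1 % p then start else ordSearch p x (suc start) fuel

-- For p prime and 1 ≤ x ≤ p-1 such k exists and k ≤ p - 1 (Fermat), so the
-- search over 1..p-1 computes exactly ord_p x.
ord : (p x : ℕ) → .{{NonZero p}} → ℕ
ord p x = ordSearch p x 1 (p ∸ 1)

F : (d p : ℕ) → .{{NonZero p}} → ℕ
F d p = length (filter (λ x → (ord p x ≟ d) ×-dec ((x ^ x) % p ≟ x % p))
                       (map suc (upTo (p ∸ 1))))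

module Submission where

-- Write p = 4k + 1.  If 1 ≤ x ≤ p - 1 has order k and x^x ≡ x (mod p),
-- then x^(x-1) ≡ 1, so k ∣ x - 1 and x ∈ {1, k+1, 2k+1, 3k+1}; x = 1 has
-- order 1 ≠ k (for k ≥ 2).  Since 2(2k+1) ≡ 1 and 4(3k+1) ≡ 1, the
-- candidate 2k+1 forces 2^k ≡ 1 and 3k+1 forces 4^k ≡ 1.
--   * p ≡ 5 (mod 8), i.e. k odd: Gauss's lemma for the prime 2 gives
--     2^(2k) ≡ (-1)^k = -1, so neither candidate occurs and F ≤ 1.
--   * p ≡ 1 (mod 8), i.e. k = 2h: if 2^k ≡ 1 then (3k+1)^h ≡ 4^(-h) = 2^(-k)
--     ≡ 1 with h < k, so 2k+1 and 3k+1 cannot both occur and F ≤ 2.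
-- The file develops, in order: a pigeonhole bound for filtered lists, the
-- arithmetic of congruences modulo p (cancellation, orders, -1 = p - 1),
-- Gauss's computation of 2^(2k) modulo 4k + 1, the analysis of the counted
-- elements for fixed k, and finally the theorem (p = 5 is checked directly).

open import Defs
open import Data.Nat using (ℕ; _≤_; _∸_; _/_; _%_; NonZero)
open import Data.Nat.Primality using (Prime)
open import Data.Product using (_×_)
open import Relation.Binary.PropositionalEquality using (_≡_)

open import Data.Nat using (zero; suc; _+_; _*_; _^_; _<_; _!; _≡ᵇ_; z≤n; s≤s; ≢-nonZero)
open import Data.Nat.Properties
open import Data.Nat.DivMod using (m≡m%n+[m/n]*n; m%n<n; %-distribˡ-*; [m+kn]%n≡m%n; %-remove-+ʳ; m*n/n≡m; m≤n⇒m%n≡m)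
open import Data.Nat.Divisibility using (_∣_; divides; ∣⇒≤; ∣1⇒≡1; m%n≡0⇒n∣m)
open import Data.Nat.Primality using (euclidsLemma; ¬prime[1])
open import Data.Nat.Tactic.RingSolver using (solve-∀)
open import Data.Product using (_,_; proj₁; proj₂; ∃-syntax)
open import Data.Sum using (_⊎_; inj₁; inj₂)
open import Data.Empty using (⊥-elim)
open import Data.Unit using (tt)
open import Data.Bool using (true; false; T)
open import Data.List using (List; []; _∷_; [_]; _++_; length; filter; map; upTo)
open import Data.List.Properties using (length-++-sucʳ)
open import Data.List.Membership.Propositional using (_∈_)
open import Data.List.Membership.Propositional.Properties using (∈-map⁻; ∈-upTo⁻; ∈-∃++; ∈-++⁻; ∈-++⁺ˡ; ∈-++⁺ʳ; ∈-filter⁻)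
open import Data.List.Relation.Binary.Subset.Propositional using (_⊆_)
open import Data.List.Relation.Unary.Unique.Propositional using (Unique)
open import Data.List.Relation.Unary.Unique.Propositional.Properties as Unique using ()
open import Data.List.Relation.Unary.All as All using ()
open import Data.List.Relation.Unary.Any using (here; there)
open import Data.List.Relation.Unary.AllPairs using (_∷_)
open import Relation.Nullary using (¬_; yes; no; contradiction)
open import Relation.Nullary.Decidable using (_×-dec_)
open import Relation.Unary using (Decidable)
open import Level using (0ℓ)
open import Relation.Binary using (Setoid; IsEquivalence)
import Relation.Binary.Reasoning.Setoid
open import Relation.Binary.PropositionalEquality using (_≢_; refl; sym; trans; cong; cong₂; subst; module ≡-Reasoning)

module _ {A : Set} where

  unique-⊆⇒length-≤ : {xs ys : List A} → Unique xs → xs ⊆ ys → length xs ≤ length ys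
  unique-⊆⇒length-≤ {[]} _ _ = z≤n
  unique-⊆⇒length-≤ {x ∷ xs} (x∉xs ∷ unique) xs⊆ys with ∈-∃++ (xs⊆ys (here refl))
  ... | ys₁ , ys₂ , refl =
    subst (length (x ∷ xs) ≤_) (sym (length-++-sucʳ ys₁ x ys₂))
          (s≤s (unique-⊆⇒length-≤ unique xs⊆ys₁++ys₂))
    where
    -- x is the only element of ys₁ ++ x ∷ ys₂ that xs cannot use
    xs⊆ys₁++ys₂ : xs ⊆ ys₁ ++ ys₂
    xs⊆ys₁++ys₂ {z} z∈xs with ∈-++⁻ ys₁ (xs⊆ys (there z∈xs))
    ... | inj₁ z∈ys₁ = ∈-++⁺ˡ z∈ys₁
    ... | inj₂ (here refl) = contradiction refl (All.lookup x∉xs z∈xs)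
    ... | inj₂ (there z∈ys₂) = ∈-++⁺ʳ ys₁ z∈ys₂

  filter-length-≤ : {P : A → Set} (P? : Decidable P) {xs : List A} (ys : List A) →
                    Unique xs → (∀ {x} → x ∈ xs → P x → x ∈ ys) →
                    length (filter P? xs) ≤ length ys
  filter-length-≤ P? ys unique candidates =
    unique-⊆⇒length-≤ (Unique.filter⁺ P? unique)
      (λ x∈filter → let (x∈xs , px) = ∈-filter⁻ P? x∈filter in candidates x∈xs px)

evens : ℕ → ℕ
evens zero = 1
evens (suc n) = suc n * 2 * evens n

odds : ℕ → ℕ
odds zero = 1
odds (suc n) = suc (n * 2) * odds n

evensAfter : ℕ → ℕ → ℕ
evensAfter c zero = 1
evensAfter c (suc n) = suc c * 2 * evensAfter (suc c) n

evens-odds : ∀ n → (n * 2) ! ≡ evens n * odds n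
evens-odds zero = refl
evens-odds (suc n) rewrite evens-odds n = rearrange (n * 2) (evens n) (odds n)
  where
  rearrange : ∀ a e o → suc (suc a) * (suc a * (e * o)) ≡ suc (suc a) * e * (suc a * o)
  rearrange = solve-∀

evens≡2^n*n! : ∀ n → evens n ≡ 2 ^ n * n !
evens≡2^n*n! zero = refl
evens≡2^n*n! (suc n) rewrite evens≡2^n*n! n = rearrange n (2 ^ n) (n !)
  where
  rearrange : ∀ n a f → suc n * 2 * (a * f) ≡ 2 * a * (suc n * f)
  rearrange = solve-∀

evens-+ : ∀ c n → evens (c + n) ≡ evens c * evensAfter c n
evens-+ c zero rewrite +-identityʳ c = sym (*-identityʳ (evens c))
evens-+ c (suc n) rewrite +-suc c n | evens-+ (suc c) n =
  rearrange (suc c * 2) (evens c) (evensAfter (suc c) n)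
  where
  rearrange : ∀ a b d → a * b * d ≡ b * (a * d)
  rearrange = solve-∀

*-^-distrib : ∀ a b n → (a * b) ^ n ≡ a ^ n * b ^ n
*-^-distrib a b zero = refl
*-^-distrib a b (suc n) rewrite *-^-distrib a b n = rearrange a b (a ^ n) (b ^ n)
  where
  rearrange : ∀ a b c d → a * b * (c * d) ≡ a * c * (b * d)
  rearrange = solve-∀

-- Congruences modulo p = q + 1 (so q plays the role of -1).

module Modulo (q : ℕ) where

  p : ℕ
  p = suc q

  -- a ≈ b means a ≡ b (mod p); a record so that both sides stay inferable.
  infix 4 _≈_
  record _≈_ (a b : ℕ) : Set where
    constructor mk≈
    field ≈⇒%≡ : a % p ≡ b % p
  open _≈_ public

  ≈-refl : ∀ {a} → a ≈ a
  ≈-refl = mk≈ refl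

  ≈-isEquivalence : IsEquivalence _≈_
  ≈-isEquivalence = record
    { refl = ≈-refl
    ; sym = λ (mk≈ e) → mk≈ (sym e)
    ; trans = λ (mk≈ e) (mk≈ f) → mk≈ (trans e f)
    }

  ≈-setoid : Setoid 0ℓ 0ℓ
  ≈-setoid = record { isEquivalence = ≈-isEquivalence }

  open IsEquivalence ≈-isEquivalence public using (reflexive) renaming (sym to ≈-sym; trans to ≈-trans)
  module ≈-Reasoning = Relation.Binary.Reasoning.Setoid ≈-setoid

  *-cong : ∀ {a a′ b b′} → a ≈ a′ → b ≈ b′ → a * b ≈ a′ * b′
  *-cong {a} {a′} {b} {b′} (mk≈ e) (mk≈ f) = mk≈ (begin
    (a * b) % p                 ≡⟨ %-distribˡ-* a b p ⟩
    ((a % p) * (b % p)) % p     ≡⟨ cong₂ (λ u v → (u * v) % p) e f ⟩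
    ((a′ % p) * (b′ % p)) % p   ≡⟨ %-distribˡ-* a′ b′ p ⟨
    (a′ * b′) % p               ∎)
    where open ≡-Reasoning

  ^-cong : ∀ {a b} → a ≈ b → ∀ n → a ^ n ≈ b ^ n
  ^-cong e zero = ≈-refl
  ^-cong e (suc n) = *-cong e (^-cong e n)

  +-multiple : ∀ a k → a + k * p ≈ a
  +-multiple a k = mk≈ ([m+kn]%n≡m%n a k p)

  ≈⇒∣∸ : ∀ {m n} → n ≤ m → m ≈ n → p ∣ m ∸ n
  ≈⇒∣∸ {m} {n} n≤m (mk≈ e) = divides (m / p ∸ n / p) (begin
    m ∸ n                                      ≡⟨ cong₂ _∸_ (m≡m%n+[m/n]*n m p) (m≡m%n+[m/n]*n n p) ⟩
    (m % p + m / p * p) ∸ (n % p + n / p * p)  ≡⟨ cong (λ r → (m % p + m / p * p) ∸ (r + n / p * p)) (sym e) ⟩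
    (m % p + m / p * p) ∸ (m % p + n / p * p)  ≡⟨ [m+n]∸[m+o]≡n∸o (m % p) _ _ ⟩
    m / p * p ∸ n / p * p                      ≡⟨ *-distribʳ-∸ p (m / p) (n / p) ⟨
    (m / p ∸ n / p) * p                        ∎)
    where open ≡-Reasoning

  ∣∸⇒≈ : ∀ {m n} → n ≤ m → p ∣ m ∸ n → m ≈ n
  ∣∸⇒≈ {m} {n} n≤m p∣m∸n = mk≈ (trans (cong (_% p) (sym (m+[n∸m]≡n n≤m))) (%-remove-+ʳ n p∣m∸n))

  -- Modulo a prime, a factor not divisible by p can be cancelled
  -- (Euclid's lemma); first for a ≥ b, where a ∸ b is the true difference.
  *-cancelʳ-≈-≥ : Prime p → ∀ {c} → ¬ p ∣ c → ∀ {a b} → b ≤ a → a * c ≈ b * c → a ≈ b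
  *-cancelʳ-≈-≥ p-prime {c} p∤c {a} {b} b≤a ac≈bc with euclidsLemma (a ∸ b) c p-prime
    (subst (p ∣_) (sym (*-distribʳ-∸ c a b)) (≈⇒∣∸ (*-monoˡ-≤ c b≤a) ac≈bc))
  ... | inj₁ p∣a∸b = ∣∸⇒≈ b≤a p∣a∸b
  ... | inj₂ p∣c = contradiction p∣c p∤c

  *-cancelʳ-≈ : Prime p → ∀ {c} → ¬ p ∣ c → ∀ {a b} → a * c ≈ b * c → a ≈ b
  *-cancelʳ-≈ p-prime p∤c {a} {b} ac≈bc with ≤-total b a
  ... | inj₁ b≤a = *-cancelʳ-≈-≥ p-prime p∤c b≤a ac≈bc
  ... | inj₂ a≤b = ≈-sym (*-cancelʳ-≈-≥ p-prime p∤c a≤b (≈-sym ac≈bc))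

  <p⇒∤ : ∀ {n} → 0 < n → n < p → ¬ p ∣ n
  <p⇒∤ (s≤s z≤n) n<p p∣n = <⇒≱ n<p (∣⇒≤ p∣n)

  prime∤! : Prime p → ∀ n → n < p → ¬ p ∣ n !
  prime∤! p-prime zero _ p∣1 = ¬prime[1] (subst Prime (∣1⇒≡1 p∣1) p-prime)
  prime∤! p-prime (suc n) n<p p∣n! with euclidsLemma (suc n) (n !) p-prime p∣n!
  ... | inj₁ p∣suc-n = <p⇒∤ (s≤s z≤n) n<p p∣suc-n
  ... | inj₂ p∣n! = prime∤! p-prime n (<-trans (n<1+n n) n<p) p∣n!

  inverse-pow : ∀ {c x} e → c * x ≈ 1 → x ^ e ≈ 1 → c ^ e ≈ 1
  inverse-pow {c} {x} e cx≈1 xᵉ≈1 = begin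
    c ^ e          ≡⟨ *-identityʳ (c ^ e) ⟨
    c ^ e * 1      ≈⟨ *-cong (≈-refl {c ^ e}) (≈-sym xᵉ≈1) ⟩
    c ^ e * x ^ e  ≡⟨ *-^-distrib c x e ⟨
    (c * x) ^ e    ≈⟨ ^-cong cx≈1 e ⟩
    1 ^ e          ≡⟨ ^-zeroˡ e ⟩
    1              ∎
    where open ≈-Reasoning

  +≡p⇒≈neg : ∀ a b → a + b ≡ p → a ≈ q * b
  +≡p⇒≈neg a b a+b≡p = begin
    a                ≈⟨ +-multiple a b ⟨
    a + b * p        ≡⟨ expand a b q ⟩
    (a + b) + q * b  ≡⟨ cong (_+ q * b) a+b≡p ⟩
    p + q * b        ≡⟨ commute q b ⟩
    q * b + 1 * p    ≈⟨ +-multiple (q * b) 1 ⟩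
    q * b            ∎
    where
    open ≈-Reasoning
    expand : ∀ a b q → a + b * suc q ≡ (a + b) + q * b
    expand = solve-∀
    commute : ∀ q b → suc q + q * b ≡ q * b + 1 * suc q
    commute = solve-∀

  -- (-1)² ≡ 1, hence odd powers of -1 are -1.
  q^odd≈q : ∀ h → q ^ suc (h * 2) ≈ q
  q^odd≈q zero = reflexive (*-identityʳ q)
  q^odd≈q (suc h) = begin
    q * (q * q ^ suc (h * 2))  ≡⟨ *-assoc q q _ ⟨
    q * q * q ^ suc (h * 2)    ≈⟨ *-cong (≈-sym (+≡p⇒≈neg 1 q refl)) (q^odd≈q h) ⟩
    1 * q                      ≡⟨ *-identityˡ q ⟩
    q                          ∎
    where open ≈-Reasoning

  q≉1 : 1 < q → ¬ q ≈ 1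
  q≉1 1<q (mk≈ q%p≡1%p) = <⇒≢ 1<q (sym (begin
    q      ≡⟨ m≤n⇒m%n≡m (≤-refl {q}) ⟨
    q % p  ≡⟨ q%p≡1%p ⟩
    1 % p  ≡⟨ m≤n⇒m%n≡m (<⇒≤ 1<q) ⟩
    1      ∎))
    where open ≡-Reasoning

  fixed-point⇒pow≈1 : Prime p → ∀ {x} → ¬ p ∣ x → ∀ n → x ^ suc n ≈ x → x ^ n ≈ 1
  fixed-point⇒pow≈1 p-prime {x} p∤x n xⁿ⁺¹≈x = *-cancelʳ-≈ p-prime p∤x (begin
    x ^ n * x  ≡⟨ *-comm (x ^ n) x ⟩
    x ^ suc n  ≈⟨ xⁿ⁺¹≈x ⟩
    x          ≡⟨ *-identityˡ x ⟨
    1 * x      ∎)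
    where open ≈-Reasoning

  record HasOrder (x d : ℕ) : Set where
    field
      pow-order≈1 : x ^ d ≈ 1
      minimal : ∀ i → 0 < i → i < d → ¬ x ^ i ≈ 1
  open HasOrder public

  ordSearch-spec : ∀ x s f → ordSearch p x s f ≢ 0 →
                   x ^ ordSearch p x s f ≈ 1 ×
                   (∀ i → s ≤ i → i < ordSearch p x s f → ¬ x ^ i ≈ 1)
  ordSearch-spec x s zero r≢0 = contradiction refl r≢0
  ordSearch-spec x s (suc f) r≢0 with (x ^ s) % p ≡ᵇ 1 % p in found
  ... | true = mk≈ (≡ᵇ⇒≡ _ _ (subst T (sym found) tt)) , λ i s≤i i<s _ → <⇒≱ i<s s≤i
  ... | false = proj₁ later , earlier
    where
    later = ordSearch-spec x (suc s) f r≢0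
    earlier : ∀ i → s ≤ i → i < ordSearch p x (suc s) f → ¬ x ^ i ≈ 1
    earlier i s≤i i<r xⁱ≈1 with m≤n⇒m<n∨m≡n s≤i
    ... | inj₁ s<i = proj₂ later i s<i i<r xⁱ≈1
    ... | inj₂ refl = subst T found (≡⇒≡ᵇ _ _ (≈⇒%≡ xⁱ≈1))

  ord⇒HasOrder : ∀ {x d} → ord p x ≡ d → d ≢ 0 → HasOrder x d
  ord⇒HasOrder {x} refl d≢0 = record
    { pow-order≈1 = proj₁ search
    ; minimal = proj₂ search
    }
    where search = ordSearch-spec x 1 q d≢0

  pow-%≈ : ∀ {x d} .{{_ : NonZero d}} → x ^ d ≈ 1 → ∀ n → x ^ n ≈ x ^ (n % d)
  pow-%≈ {x} {d} xᵈ≈1 n = begin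
    x ^ n                            ≡⟨ cong (x ^_) (m≡m%n+[m/n]*n n d) ⟩
    x ^ (n % d + n / d * d)          ≡⟨ ^-distribˡ-+-* x (n % d) (n / d * d) ⟩
    x ^ (n % d) * x ^ (n / d * d)    ≡⟨ cong (λ e → x ^ (n % d) * x ^ e) (*-comm (n / d) d) ⟩
    x ^ (n % d) * x ^ (d * (n / d))  ≡⟨ cong (x ^ (n % d) *_) (^-*-assoc x d (n / d)) ⟨
    x ^ (n % d) * (x ^ d) ^ (n / d)  ≈⟨ *-cong (≈-refl {x ^ (n % d)}) (^-cong xᵈ≈1 (n / d)) ⟩
    x ^ (n % d) * 1 ^ (n / d)        ≡⟨ cong (x ^ (n % d) *_) (^-zeroˡ (n / d)) ⟩
    x ^ (n % d) * 1                  ≡⟨ *-identityʳ (x ^ (n % d)) ⟩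
    x ^ (n % d)                      ∎
    where open ≈-Reasoning

  order-∣ : ∀ {x d n} .{{_ : NonZero d}} → HasOrder x d → x ^ n ≈ 1 → d ∣ n
  order-∣ {x} {d} {n} order xⁿ≈1 with n % d in remainder
  ... | zero = m%n≡0⇒n∣m n d remainder
  ... | suc r = ⊥-elim (minimal order (suc r) (s≤s z≤n) (subst (_< d) remainder (m%n<n n d))
                  (subst (λ e → x ^ e ≈ 1) remainder (≈-trans (≈-sym (pow-%≈ (pow-order≈1 order) n)) xⁿ≈1)))

  -- The even numbers 2c+2, …, 2c+2n are congruent to -(2n-1), …, -1 when
  -- 2c + 2n + 1 = p.
  evensAfter≈ : ∀ n c → c * 2 + n * 2 + 1 ≡ p → evensAfter c n ≈ q ^ n * odds n
  evensAfter≈ zero c _ = ≈-refl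
  evensAfter≈ (suc n) c e = begin
    suc c * 2 * evensAfter (suc c) n    ≈⟨ *-cong (+≡p⇒≈neg (suc c * 2) (suc (n * 2)) (trans (regroup₁ c n) e))
                                                  (evensAfter≈ n (suc c) (trans (regroup₂ c n) e)) ⟩
    q * suc (n * 2) * (q ^ n * odds n)  ≡⟨ rearrange q (suc (n * 2)) (q ^ n) (odds n) ⟩
    q ^ suc n * odds (suc n)            ∎
    where
    open ≈-Reasoning
    regroup₁ : ∀ c n → suc c * 2 + suc (n * 2) ≡ c * 2 + suc n * 2 + 1
    regroup₁ = solve-∀
    regroup₂ : ∀ c n → suc c * 2 + n * 2 + 1 ≡ c * 2 + suc n * 2 + 1
    regroup₂ = solve-∀
    rearrange : ∀ a b c d → a * b * (c * d) ≡ a * c * (b * d)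
    rearrange = solve-∀

  -- Gauss's lemma for the prime 2 when p = 4k + 1: 2^(2k) ≡ (-1)^k, obtained
  -- by comparing 2^(2k) (2k)! = 2 · 4 ⋯ 4k with (2k)! and cancelling (2k)!.
  two-pow≈ : Prime p → ∀ k → q ≡ k * 4 → 2 ^ (k * 2) ≈ q ^ k
  two-pow≈ p-prime k q≡4k = *-cancelʳ-≈ p-prime (prime∤! p-prime (k * 2) 2k<p) (begin
    2 ^ (k * 2) * (k * 2) !     ≡⟨ evens≡2^n*n! (k * 2) ⟨
    evens (k * 2)               ≡⟨ cong evens (double k) ⟩
    evens (k + k)               ≡⟨ evens-+ k k ⟩
    evens k * evensAfter k k    ≈⟨ *-cong (≈-refl {evens k}) (evensAfter≈ k k 4k+1≡p) ⟩
    evens k * (q ^ k * odds k)  ≡⟨ rearrange (evens k) (q ^ k) (odds k) ⟩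
    q ^ k * (evens k * odds k)  ≡⟨ cong (q ^ k *_) (evens-odds k) ⟨
    q ^ k * (k * 2) !           ∎)
    where
    open ≈-Reasoning
    double : ∀ k → k * 2 ≡ k + k
    double = solve-∀
    rearrange : ∀ e a o → e * (a * o) ≡ a * (e * o)
    rearrange = solve-∀
    quadruple : ∀ k → k * 2 + k * 2 + 1 ≡ suc (k * 4)
    quadruple = solve-∀
    4k+1≡p : k * 2 + k * 2 + 1 ≡ p
    4k+1≡p = trans (quadruple k) (cong suc (sym q≡4k))
    2k<p : k * 2 < p
    2k<p = s≤s (subst (k * 2 ≤_) (sym q≡4k) (*-monoʳ-≤ k (s≤s (s≤s z≤n))))

half-bounds : ∀ h → 1 < h * 2 → 0 < h × h < h * 2
half-bounds (suc h) _ = s≤s z≤n , m<m*n (suc h) 2 (s≤s (s≤s z≤n))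

parity : ∀ n → (∃[ h ] n ≡ h * 2) ⊎ (∃[ h ] n ≡ suc (h * 2))
parity zero = inj₁ (0 , refl)
parity (suc n) with parity n
... | inj₁ (h , refl) = inj₂ (h , refl)
... | inj₂ (h , refl) = inj₁ (suc h , refl)

even⇒4k+1%8≡1 : ∀ {k} h → k ≡ h * 2 → suc (k * 4) % 8 ≡ 1
even⇒4k+1%8≡1 h refl = trans (cong (λ e → suc e % 8) (*-assoc h 2 4)) ([m+kn]%n≡m%n 1 h 8)

module QuarterOrder (k : ℕ) (1<k : 1 < k) (p-prime : Prime (suc (k * 4))) where

  open Modulo (k * 4)

  instance
    k-nonZero : NonZero k
    k-nonZero = ≢-nonZero (m<n⇒n≢0 1<k)

  Counted : ℕ → Set
  Counted x = (ord p x ≡ k) × ((x ^ x) % p ≡ x % p)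

  counted? : Decidable Counted
  counted? x = (ord p x ≟ k) ×-dec ((x ^ x) % p ≟ x % p)

  residues : List ℕ
  residues = map suc (upTo (k * 4))

  residues-unique : Unique residues
  residues-unique = Unique.map⁺ suc-injective (Unique.upTo⁺ (k * 4))

  counted⇒HasOrder : ∀ {x} → Counted x → HasOrder x k
  counted⇒HasOrder (ord≡k , _) = ord⇒HasOrder ord≡k (m<n⇒n≢0 1<k)

  -- Among the numbers 1 + j k with j < 4, a counted one has j ≠ 0,
  -- because 1 has order 1 < k.
  counted-multiple : ∀ j → j < 4 → Counted (suc (j * k)) →
                     suc (j * k) ≡ suc (1 * k) ⊎ suc (j * k) ≡ suc (2 * k) ⊎ suc (j * k) ≡ suc (3 * k)
  counted-multiple 0 _ counted = ⊥-elim (minimal (counted⇒HasOrder counted) 1 (s≤s z≤n) 1<k ≈-refl)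
  counted-multiple 1 _ _ = inj₁ refl
  counted-multiple 2 _ _ = inj₂ (inj₁ refl)
  counted-multiple 3 _ _ = inj₂ (inj₂ refl)
  counted-multiple (suc (suc (suc (suc _)))) (s≤s (s≤s (s≤s (s≤s ())))) _

  -- A counted x satisfies x^(x-1) ≡ 1, so k ∣ x - 1; as x ≤ 4k, the
  -- counted residues are among k + 1, 2k + 1 and 3k + 1.
  candidates : ∀ {x} → x ∈ residues → Counted x →
               x ≡ suc (1 * k) ⊎ x ≡ suc (2 * k) ⊎ x ≡ suc (3 * k)
  candidates x∈residues counted with ∈-map⁻ suc x∈residues
  ... | y , y∈upTo , refl = multiple (order-∣ (counted⇒HasOrder counted) y^y≈1) counted
    where
    y<4k : y < k * 4
    y<4k = ∈-upTo⁻ y∈upTo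
    y^y≈1 : suc y ^ y ≈ 1
    y^y≈1 = fixed-point⇒pow≈1 p-prime (<p⇒∤ (s≤s z≤n) (s≤s y<4k)) y (mk≈ (proj₂ counted))
    multiple : k ∣ y → Counted (suc y) → suc y ≡ suc (1 * k) ⊎ suc y ≡ suc (2 * k) ⊎ suc y ≡ suc (3 * k)
    multiple (divides j refl) = counted-multiple j (*-cancelʳ-< k j 4 (subst (j * k <_) (*-comm k 4) y<4k))

  2*[2k+1]≈1 : 2 * suc (2 * k) ≈ 1
  2*[2k+1]≈1 = ≈-trans (reflexive (expand k)) (+-multiple 1 1)
    where
    expand : ∀ k → 2 * suc (2 * k) ≡ 1 + 1 * suc (k * 4)
    expand = solve-∀

  4*[3k+1]≈1 : 4 * suc (3 * k) ≈ 1
  4*[3k+1]≈1 = ≈-trans (reflexive (expand k)) (+-multiple 1 3)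
    where
    expand : ∀ k → 4 * suc (3 * k) ≡ 1 + 3 * suc (k * 4)
    expand = solve-∀

  counted-2k+1⇒2^k≈1 : Counted (suc (2 * k)) → 2 ^ k ≈ 1
  counted-2k+1⇒2^k≈1 counted = inverse-pow k 2*[2k+1]≈1 (pow-order≈1 (counted⇒HasOrder counted))

  counted-3k+1⇒4^k≈1 : Counted (suc (3 * k)) → 4 ^ k ≈ 1
  counted-3k+1⇒4^k≈1 counted = inverse-pow k 4*[3k+1]≈1 (pow-order≈1 (counted⇒HasOrder counted))

  -- k odd (p ≡ 5 mod 8): by Gauss's lemma 2^(2k) ≡ (-1)^k ≡ -1, so neither
  -- 2k + 1 nor 3k + 1 is counted and only k + 1 remains.
  module Odd (h : ℕ) (k-odd : k ≡ suc (h * 2)) where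

    2^[2k]≉1 : ¬ 2 ^ (k * 2) ≈ 1
    2^[2k]≉1 2^[2k]≈1 = q≉1 (<-≤-trans 1<k (m≤m*n k 4)) (begin
      k * 4                ≈⟨ subst (λ e → (k * 4) ^ e ≈ k * 4) (sym k-odd) (q^odd≈q h) ⟨
      (k * 4) ^ k          ≈⟨ two-pow≈ p-prime k refl ⟨
      2 ^ (k * 2)          ≈⟨ 2^[2k]≈1 ⟩
      1                    ∎)
      where open ≈-Reasoning

    2k+1-not-counted : ¬ Counted (suc (2 * k))
    2k+1-not-counted counted = 2^[2k]≉1 (begin
      2 ^ (k * 2)  ≡⟨ ^-*-assoc 2 k 2 ⟨
      (2 ^ k) ^ 2  ≈⟨ ^-cong (counted-2k+1⇒2^k≈1 counted) 2 ⟩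
      1            ∎)
      where open ≈-Reasoning

    3k+1-not-counted : ¬ Counted (suc (3 * k))
    3k+1-not-counted counted = 2^[2k]≉1 (begin
      2 ^ (k * 2)  ≡⟨ cong (2 ^_) (*-comm k 2) ⟩
      2 ^ (2 * k)  ≡⟨ ^-*-assoc 2 2 k ⟨
      4 ^ k        ≈⟨ counted-3k+1⇒4^k≈1 counted ⟩
      1            ∎)
      where open ≈-Reasoning

    F≤1 : F k p ≤ 1
    F≤1 = filter-length-≤ counted? [ suc (1 * k) ] residues-unique only-k+1
      where
      only-k+1 : ∀ {x} → x ∈ residues → Counted x → x ∈ [ suc (1 * k) ]
      only-k+1 x∈residues counted with candidates x∈residues counted
      ... | inj₁ refl = here refl
      ... | inj₂ (inj₁ refl) = contradiction counted 2k+1-not-counted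
      ... | inj₂ (inj₂ refl) = contradiction counted 3k+1-not-counted

  -- k = 2h even (p ≡ 1 mod 8): if 2k + 1 is counted then 2^k ≡ 1, so
  -- (3k + 1)^h ≡ 4^(-h) = 2^(-k) ≡ 1 with 0 < h < k, and 3k + 1 is not.
  module Even (h : ℕ) (k-even : k ≡ h * 2) where

    not-both : Counted (suc (2 * k)) → ¬ Counted (suc (3 * k))
    not-both counted₂ counted₃ =
      minimal (counted⇒HasOrder counted₃) h 0<h h<k
        (inverse-pow h (≈-trans (reflexive (*-comm (suc (3 * k)) 4)) 4*[3k+1]≈1) 4^h≈1)
      where
      open ≈-Reasoning
      halves = half-bounds h (subst (1 <_) k-even 1<k)
      0<h = proj₁ halves
      h<k = subst (h <_) (sym k-even) (proj₂ halves)
      4^h≈1 : 4 ^ h ≈ 1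
      4^h≈1 = begin
        4 ^ h        ≡⟨ ^-*-assoc 2 2 h ⟩
        2 ^ (2 * h)  ≡⟨ cong (2 ^_) (trans (*-comm 2 h) (sym k-even)) ⟩
        2 ^ k        ≈⟨ counted-2k+1⇒2^k≈1 counted₂ ⟩
        1            ∎

    F≤2 : F k p ≤ 2
    F≤2 with counted? (suc (2 * k))
    ... | yes counted₂ = filter-length-≤ counted? (suc (1 * k) ∷ suc (2 * k) ∷ []) residues-unique without-3k+1
      where
      without-3k+1 : ∀ {x} → x ∈ residues → Counted x → x ∈ suc (1 * k) ∷ suc (2 * k) ∷ []
      without-3k+1 x∈residues counted with candidates x∈residues counted
      ... | inj₁ refl = here refl
      ... | inj₂ (inj₁ refl) = there (here refl)
      ... | inj₂ (inj₂ refl) = contradiction counted (not-both counted₂)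
    ... | no not-counted₂ = filter-length-≤ counted? (suc (1 * k) ∷ suc (3 * k) ∷ []) residues-unique without-2k+1
      where
      without-2k+1 : ∀ {x} → x ∈ residues → Counted x → x ∈ suc (1 * k) ∷ suc (3 * k) ∷ []
      without-2k+1 x∈residues counted with candidates x∈residues counted
      ... | inj₁ refl = here refl
      ... | inj₂ (inj₁ refl) = contradiction counted not-counted₂
      ... | inj₂ (inj₂ refl) = there (here refl)

Conclusion : (d p : ℕ) .{{_ : NonZero p}} → Set
Conclusion d p = (p % 8 ≡ 1 → F d p ≤ 2) × (p % 8 ≡ 5 → F d p ≤ 1)

-- The theorem for p = 4k + 1, split by the parity of k; p = 5 (k = 1),
-- where F 1 5 = 1, is settled by evaluation.
conclusion-4k+1 : ∀ k → Prime (suc (k * 4)) → Conclusion k (suc (k * 4))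
conclusion-4k+1 0 p-prime = ⊥-elim (¬prime[1] p-prime)
conclusion-4k+1 1 _ = (λ ()) , (λ _ → s≤s z≤n)
conclusion-4k+1 k@(suc (suc _)) p-prime with parity k
... | inj₁ (h , k-even) =
  (λ _ → Even.F≤2 h k-even) ,
  (λ p%8≡5 → contradiction (trans (sym (even⇒4k+1%8≡1 h k-even)) p%8≡5) λ ())
  where open QuarterOrder k (s≤s (s≤s z≤n)) p-prime
... | inj₂ (h , k-odd) = (λ _ → m≤n⇒m≤1+n (Odd.F≤1 h k-odd)) , (λ _ → Odd.F≤1 h k-odd)
  where open QuarterOrder k (s≤s (s≤s z≤n)) p-prime

conclusion : ∀ k p .{{_ : NonZero p}} → p ≡ suc (k * 4) → Prime p → Conclusion ((p ∸ 1) / 4) p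
conclusion k _ refl p-prime =
  subst (λ d → Conclusion d (suc (k * 4))) (sym (m*n/n≡m k 4)) (conclusion-4k+1 k p-prime)

mainTheorem7 : (p : ℕ) → .{{_ : NonZero p}} → Prime p → p % 4 ≡ 1 →
               ((p % 8 ≡ 1 → F ((p ∸ 1) / 4) p ≤ 2)
               × (p % 8 ≡ 5 → F ((p ∸ 1) / 4) p ≤ 1))
mainTheorem7 p p-prime p%4≡1 = conclusion (p / 4) p p≡4k+1 p-prime
  where
  p≡4k+1 : p ≡ suc (p / 4 * 4)
  p≡4k+1 = trans (m≡m%n+[m/n]*n p 4) (cong (_+ p / 4 * 4) p%4≡1)
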